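{- For every $k\geq 0$, the polynomial $H_k(x)$ is symmetric: writing $H_k(x)=\sum_{i=0}^{k+1}\sum_{j=0}^{2k+1}h_k(i,j)x^{2(k+1)i+j}$, one has $h_k(i,j)=h_k(k+1-i,\,2k+1-j)$ for all $0\leq i\leq k+1$ and $0\leq j\leq 2k+1$; equivalently, the coefficient of $x^m$ in $H_k(x)$ equals the coefficient of $x^{2(k+1)(k+2)-1-m}$ for all $0\leq m\leq 2(k+1)(k+2)-1$.
   Context: $B_n$ is the set of signed permutations of $[n]$ (permutations with possible minus signs on entries); $\mathrm{des}_B(\pi)$ is the number of $i\in\{0,\dots,n-1\}$ with $\pi_i>\pi_{i+1}$ where $\pi_0=0$; $B_n(t)=\sum_{\pi\in B_n}t^{\mathrm{des}_B(\pi)}$ is the type $B$ Eulerian polynomial ($B_0=1$). Define \[ H_k(x)=\sum_{l=0}^{k}B_{k-l}(x^{2k+2})(x^{2k+2}-1)^l\sum_{s=l}^{k}\binom{s}{l}x^{2k+1-s}+\sum_{l=0}^{k}B_{k-l}(x^{ -2k-2})(x^{ -2k-2}-1)^l\sum_{s=l}^{k}\binom{s}{l}x^{2(k+1)^2+s}. \] -}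

module Defs where

open import Data.Nat as ℕ using (ℕ; zero; suc; _∸_)
open import Data.Nat.Combinatorics using (_C_)
open import Data.Integer as ℤ using (ℤ; +_; -[1+_]; ∣_∣)
import Data.Integer.Properties as ℤP
open import Data.List using (List; []; _∷_; [_]; _++_; map; concatMap; upTo; filterᵇ; foldr; length)
open import Data.Bool.ListAction using (any)
open import Data.Product using (_×_; _,_)
open import Data.Bool using (Bool; true; false; _∧_; not; if_then_else_)
open import Relation.Nullary.Decidable using (does)

-- Laurent polynomials in x with integer coefficients, represented as
-- finite formal sums of terms (exponent , coefficient).

LPoly : Set
LPoly = List (ℤ × ℤ)

coeff : LPoly → ℤ → ℤ
coeff []            m = + 0
coeff ((e , c) ∷ p) m = (if does (e ℤ.≟ m) then c else + 0) ℤ.+ coeff p m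

mono : ℤ → ℤ → LPoly
mono e c = [ (e , c) ]

one : LPoly
one = mono (+ 0) (+ 1)

_⊕_ : LPoly → LPoly → LPoly
p ⊕ q = p ++ q

_⊗_ : LPoly → LPoly → LPoly
p ⊗ q = concatMap (λ { (a , c) → map (λ { (b , d) → (a ℤ.+ b , c ℤ.* d) }) q }) p

_^^_ : LPoly → ℕ → LPoly
p ^^ zero  = one
p ^^ suc n = p ⊗ (p ^^ n)

substPow : ℤ → LPoly → LPoly
substPow e p = map (λ { (a , c) → (e ℤ.* a , c) }) p

-- Signed permutations of [n]: words π₁ … πₙ with entries in
-- {±1, …, ±n} whose absolute values are pairwise distinct.

signedValues : ℕ → List ℤ
signedValues n = map (λ i → + suc i) (upTo n) ++ map (λ i → -[1+ i ]) (upTo n)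

words : ℕ → ℕ → List (List ℤ)
words zero    n = [ [] ]
words (suc m) n = concatMap (λ v → map (v ∷_) (words m n)) (signedValues n)

distinctAbs : List ℤ → Bool
distinctAbs []       = true
distinctAbs (a ∷ as) = not (any (λ b → does (∣ a ∣ ℕ.≟ ∣ b ∣)) as) ∧ distinctAbs as

signedPerms : ℕ → List (List ℤ)
signedPerms n = filterᵇ distinctAbs (words n n)

descents : List ℤ → ℕ
descents []            = 0
descents (a ∷ [])      = 0
descents (a ∷ b ∷ r)   = (if does (b ℤP.<? a) then 1 else 0) ℕ.+ descents (b ∷ r)

desB : List ℤ → ℕ
desB π = descents (+ 0 ∷ π)

eulerB : ℕ → LPoly
eulerB n = map (λ π → (+ desB π , + 1)) (signedPerms n)

H : ℕ → LPoly
H k = concatMap term₁ (upTo (suc k)) ⊕ concatMap term₂ (upTo (suc k))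
  where
  e : ℤ
  e = + (2 ℕ.* suc k)
  range : ℕ → List ℕ
  range l = map (l ℕ.+_) (upTo (suc k ∸ l))
  term₁ : ℕ → LPoly
  term₁ l = (substPow e (eulerB (k ∸ l)) ⊗ ((mono e (+ 1) ⊕ mono (+ 0) (ℤ.- + 1)) ^^ l))
            ⊗ concatMap (λ s → mono (+ (2 ℕ.* k ℕ.+ 1) ℤ.- + s) (+ (s C l))) (range l)
  term₂ : ℕ → LPoly
  term₂ l = (substPow (ℤ.- e) (eulerB (k ∸ l)) ⊗ ((mono (ℤ.- e) (+ 1) ⊕ mono (+ 0) (ℤ.- + 1)) ^^ l))
            ⊗ concatMap (λ s → mono (+ (2 ℕ.* (suc k ℕ.* suc k) ℕ.+ s)) (+ (s C l))) (range l)

-- Let N = 2(k+1)(k+2) − 1 = 2(k+1)² + 2k + 1 and let P be the first sum in H_k.  Summand by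
-- summand, the second sum is x^N P(x⁻¹): the substitution x ↦ x⁻¹ turns B(x^{2k+2}) and
-- (x^{2k+2} − 1)^l into B(x^{−2k−2}) and (x^{−2k−2} − 1)^l, and sends x^{2k+1−s} to x^{s−2k−1},
-- which x^N shifts to x^{2(k+1)²+s}.  So H_k = P + x^N P(x⁻¹), whose coefficient of x^m is
-- [x^m]P + [x^{N−m}]P, a quantity invariant under m ↦ N − m.  Nothing about B_n is used.
module Submission where

open import Defs
open import Data.Nat using (ℕ; suc; _*_; _∸_; _≤_)
open import Data.Integer using (+_)
open import Relation.Binary.PropositionalEquality using (_≡_)

import Data.Nat as ℕ
import Data.Integer as ℤ
open import Data.Integer using (ℤ; -_; _-_)
import Data.Integer.Properties as ℤP
open import Data.Integer.Tactic.RingSolver using (solve-∀)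
open import Data.Nat.Tactic.RingSolver as ℕSolver using ()
open import Data.Nat.Combinatorics using (_C_)
open import Data.List using (List; []; _∷_; _++_; map; concatMap; upTo)
open import Data.List.Properties using (map-++; map-concatMap; concatMap-cong)
open import Data.Product using (_,_; map₁)
open import Data.Bool using (if_then_else_)
open import Relation.Nullary using (yes; no; does)
open import Relation.Nullary.Negation using (contradiction)
open import Relation.Binary.PropositionalEquality
  using (refl; sym; trans; cong; cong₂; module ≡-Reasoning)

reindex : (ℤ → ℤ) → LPoly → LPoly
reindex f = map (map₁ f)

coeff-⊕ : ∀ p q m → coeff (p ⊕ q) m ≡ coeff p m ℤ.+ coeff q m
coeff-⊕ []            q m = sym (ℤP.+-identityˡ _)
coeff-⊕ ((e , c) ∷ p) q m = trans (cong (ℤ._+_ cₘ) (coeff-⊕ p q m)) (sym (ℤP.+-assoc cₘ _ _))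
  where
  cₘ : ℤ
  cₘ = if does (e ℤ.≟ m) then c else + 0

coeff-reindex-involutive : ∀ {f} → (∀ a → f (f a) ≡ a) →
                           ∀ p m → coeff (reindex f p) m ≡ coeff p (f m)
coeff-reindex-involutive inv [] m = refl
coeff-reindex-involutive {f} inv ((e , c) ∷ p) m with f e ℤ.≟ m | e ℤ.≟ f m
... | yes _     | yes _     = cong (ℤ._+_ c) (coeff-reindex-involutive inv p m)
... | no _      | no _      = cong (ℤ._+_ (+ 0)) (coeff-reindex-involutive inv p m)
... | yes fe≡m  | no e≢fm   = contradiction (trans (sym (inv e)) (cong f fe≡m)) e≢fm
... | no fe≢m   | yes e≡fm  = contradiction (trans (cong f e≡fm) (inv m)) fe≢m

module _ {f g h : ℤ → ℤ} (split : ∀ a b → f (a ℤ.+ b) ≡ g a ℤ.+ h b) where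

  reindex-⊗ : ∀ p q → reindex f (p ⊗ q) ≡ reindex g p ⊗ reindex h q
  reindex-⊗ []            q = refl
  reindex-⊗ ((a , c) ∷ p) q =
    trans (map-++ (map₁ f) _ (p ⊗ q)) (cong₂ _++_ (row q) (reindex-⊗ p q))
    where
    row : ∀ q → reindex f (map (λ { (b , d) → (a ℤ.+ b , c ℤ.* d) }) q)
              ≡ map (λ { (b , d) → (g a ℤ.+ b , c ℤ.* d) }) (reindex h q)
    row []            = refl
    row ((b , d) ∷ q) = cong₂ _∷_ (cong (_, c ℤ.* d) (split a b)) (row q)

reindex-^^ : ∀ {f} → (∀ a b → f (a ℤ.+ b) ≡ f a ℤ.+ f b) → f (+ 0) ≡ + 0 →
             ∀ p n → reindex f (p ^^ n) ≡ reindex f p ^^ n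
reindex-^^ additive f0≡0 p ℕ.zero    = cong (λ e → (e , + 1) ∷ []) f0≡0
reindex-^^ {f} additive f0≡0 p (ℕ.suc n) =
  trans (reindex-⊗ additive p (p ^^ n)) (cong (reindex f p ⊗_) (reindex-^^ additive f0≡0 p n))

reindex-neg-substPow : ∀ e p → reindex -_ (substPow e p) ≡ substPow (- e) p
reindex-neg-substPow e []            = refl
reindex-neg-substPow e ((a , c) ∷ p) =
  cong₂ _∷_ (cong (_, c) (ℤP.neg-distribˡ-* e a)) (reindex-neg-substPow e p)

reflect : ℤ → ℤ → ℤ
reflect n a = n - a

reflect-involutive : ∀ n a → reflect n (reflect n a) ≡ a
reflect-involutive = solve-∀

reflect-+ : ∀ n a b → reflect n (a ℤ.+ b) ≡ - a ℤ.+ reflect n b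
reflect-+ = solve-∀

reflect-pos : ∀ {n m} → m ≤ n → reflect (+ n) (+ m) ≡ + (n ∸ m)
reflect-pos {n} {m} m≤n = trans (ℤP.m-n≡m⊖n n m) (ℤP.⊖-≥ m≤n)

-- p + x^n p(x⁻¹)
palindromize : ℤ → LPoly → LPoly
palindromize n p = p ⊕ reindex (reflect n) p

coeff-palindromize : ∀ n p m →
  coeff (palindromize n p) m ≡ coeff (palindromize n p) (reflect n m)
coeff-palindromize n p m = begin
  coeff (palindromize n p) m              ≡⟨ coeff-⊕ p _ m ⟩
  coeff p m ℤ.+ coeff p′ m                ≡⟨ cong₂ ℤ._+_ (cong (coeff p) (sym (reflect-involutive n m)))
                                                         (coeff-reflect m) ⟩
  coeff p (r (r m)) ℤ.+ coeff p (r m)     ≡⟨ ℤP.+-comm (coeff p (r (r m))) _ ⟩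
  coeff p (r m) ℤ.+ coeff p (r (r m))     ≡⟨ cong (ℤ._+_ (coeff p (r m))) (sym (coeff-reflect (r m))) ⟩
  coeff p (r m) ℤ.+ coeff p′ (r m)        ≡⟨ sym (coeff-⊕ p _ (r m)) ⟩
  coeff (palindromize n p) (r m)          ∎
  where
  open ≡-Reasoning
  r : ℤ → ℤ
  r = reflect n
  p′ : LPoly
  p′ = reindex r p
  coeff-reflect : ∀ m → coeff p′ m ≡ coeff p (r m)
  coeff-reflect = coeff-reindex-involutive (reflect-involutive n) p

module HAsPalindromization (k : ℕ) where

  degree : ℕ
  degree = 2 * suc k * suc (suc k) ∸ 1

  degree≡ : degree ≡ 2 ℕ.* (suc k ℕ.* suc k) ℕ.+ (2 ℕ.* k ℕ.+ 1)
  degree≡ = cong (_∸ 1) (identity k)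
    where
    identity : ∀ k → 2 * suc k * suc (suc k)
                   ≡ suc (2 ℕ.* (suc k ℕ.* suc k) ℕ.+ (2 ℕ.* k ℕ.+ 1))
    identity = ℕSolver.solve-∀

  e : ℤ
  e = + (2 ℕ.* suc k)

  range : ℕ → List ℕ
  range l = map (l ℕ.+_) (upTo (suc k ∸ l))

  low high : ℕ → LPoly
  low  l = concatMap (λ s → mono (+ (2 ℕ.* k ℕ.+ 1) - + s) (+ (s C l))) (range l)
  high l = concatMap (λ s → mono (+ (2 ℕ.* (suc k ℕ.* suc k) ℕ.+ s)) (+ (s C l))) (range l)

  term₁ term₂ : ℕ → LPoly
  term₁ l = (substPow e (eulerB (k ∸ l)) ⊗ ((mono e (+ 1) ⊕ mono (+ 0) (- + 1)) ^^ l)) ⊗ low l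
  term₂ l = (substPow (- e) (eulerB (k ∸ l)) ⊗ ((mono (- e) (+ 1) ⊕ mono (+ 0) (- + 1)) ^^ l))
            ⊗ high l

  reflect-low : ∀ l → reindex (reflect (+ degree)) (low l) ≡ high l
  reflect-low l = trans (map-concatMap _ _ (range l)) (concatMap-cong exponent (range l))
    where
    exponent : ∀ s → reindex (reflect (+ degree)) (mono (+ (2 ℕ.* k ℕ.+ 1) - + s) (+ (s C l)))
                   ≡ mono (+ (2 ℕ.* (suc k ℕ.* suc k) ℕ.+ s)) (+ (s C l))
    exponent s = cong (λ x → (x , + (s C l)) ∷ []) (begin
      + degree - (+ b - + s)      ≡⟨ cong (λ d → + d - (+ b - + s)) degree≡ ⟩
      + (a ℕ.+ b) - (+ b - + s)   ≡⟨ cong (_- (+ b - + s)) (ℤP.pos-+ a b) ⟩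
      (+ a ℤ.+ + b) - (+ b - + s) ≡⟨ cancel (+ a) (+ b) (+ s) ⟩
      + a ℤ.+ + s                 ≡⟨ sym (ℤP.pos-+ a s) ⟩
      + (a ℕ.+ s)                 ∎)
      where
      open ≡-Reasoning
      a b : ℕ
      a = 2 ℕ.* (suc k ℕ.* suc k)
      b = 2 ℕ.* k ℕ.+ 1
      cancel : ∀ x y z → (x ℤ.+ y) - (y - z) ≡ x ℤ.+ z
      cancel = solve-∀

  reflect-term : ∀ l → reindex (reflect (+ degree)) (term₁ l) ≡ term₂ l
  reflect-term l = begin
    reindex (reflect (+ degree)) ((S ⊗ (F ^^ l)) ⊗ low l)
      ≡⟨ reindex-⊗ (reflect-+ (+ degree)) (S ⊗ (F ^^ l)) (low l) ⟩
    reindex -_ (S ⊗ (F ^^ l)) ⊗ reindex (reflect (+ degree)) (low l)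
      ≡⟨ cong₂ _⊗_ (reindex-⊗ ℤP.neg-distrib-+ S (F ^^ l)) (reflect-low l) ⟩
    (reindex -_ S ⊗ reindex -_ (F ^^ l)) ⊗ high l
      ≡⟨ cong (λ q → q ⊗ high l) (cong₂ _⊗_ (reindex-neg-substPow e (eulerB (k ∸ l)))
                                             (reindex-^^ ℤP.neg-distrib-+ refl F l)) ⟩
    term₂ l ∎
    where
    open ≡-Reasoning
    S F : LPoly
    S = substPow e (eulerB (k ∸ l))
    F = mono e (+ 1) ⊕ mono (+ 0) (- + 1)

  H≡palindromize : H k ≡ palindromize (+ degree) (concatMap term₁ (upTo (suc k)))
  H≡palindromize = cong (concatMap term₁ (upTo (suc k)) ⊕_) (sym (reflect-terms (upTo (suc k))))
    where
    reflect-terms : ∀ ls → reindex (reflect (+ degree)) (concatMap term₁ ls) ≡ concatMap term₂ ls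
    reflect-terms ls = trans (map-concatMap _ term₁ ls) (concatMap-cong reflect-term ls)

corollary3p3 : (k m : ℕ) → m ≤ 2 * suc k * suc (suc k) ∸ 1 →
    coeff (H k) (+ m) ≡ coeff (H k) (+ (2 * suc k * suc (suc k) ∸ 1 ∸ m))
corollary3p3 k m m≤degree = begin
  coeff (H k) (+ m)                           ≡⟨ cong (λ p → coeff p (+ m)) H≡palindromize ⟩
  coeff (palindromize (+ degree) P) (+ m)     ≡⟨ coeff-palindromize (+ degree) P (+ m) ⟩
  coeff (palindromize (+ degree) P) (reflect (+ degree) (+ m))
                                              ≡⟨ cong₂ coeff (sym H≡palindromize) (reflect-pos m≤degree) ⟩
  coeff (H k) (+ (degree ∸ m))                ∎
  where
  open ≡-Reasoning
  open HAsPalindromization k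
  P : LPoly
  P = concatMap term₁ (upTo (suc k))
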